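{- Let $H$ be a graph with a $k$-clique-partition $\mathcal{Q}$ and a frozen $(k+1)$-clique-partition $\mathcal{F}$, and let $x,y$ be adjacent vertices of $H$ lying in different cliques of $\mathcal{Q}$, such that either (1) $x$ and $y$ are in different cliques of $\mathcal{F}$, or (2) $\{x,y\}$ is one of the cliques of $\mathcal{F}$. Let $H'$ be obtained from $H$ by deleting the edge $xy$, adding two new vertices $u,v$, and adding the edges $xu$, $uv$, $vy$ (so $xy$ is replaced by the path $x,u,v,y$). Then $H'$ has a $(k+1)$-clique-partition and admits a frozen $(k+2)$-clique-partition. Furthermore: (3) if $\theta(H)=k$, then $\theta(H')=k+1$; (4) if $H$ is $C_4$-free and, in case (1), $xy$ is not the middle edge of a diamond in $H$, then $H'$ is $C_4$-free.
   Context: A $k$-clique-partition of a graph $H$ is a partition of $V(H)$ into at most $k$ (ordered, possibly empty) cliques; $\theta(H)$ is the least $k$ for which $H$ has a $k$-clique-partition. A $k$-clique-partition is frozen if every vertex $v$ has a non-neighbour in each of the $k$ cliques other than the one containing $v$. The diamond is $K_4$ minus one edge; its middle edge is the edge joining its two vertices of degree 3. $H$ is $C_4$-free if no induced subgraph of $H$ is a cycle on four vertices. -}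

module Defs where

open import Data.Nat using (ℕ; zero; suc; _+_; _<_)
open import Data.Fin using (Fin; zero; suc; _≟_)
open import Data.Bool using (Bool; true; false; _∧_; _∨_; not)
open import Data.Bool.Properties using (∧-comm; ∨-comm)
open import Data.Product using (Σ; _×_; _,_; ∃)
open import Data.Sum using (_⊎_)
open import Data.Empty using (⊥)
open import Relation.Nullary using (¬_)
open import Relation.Nullary.Decidable using (⌊_⌋)
open import Relation.Binary.PropositionalEquality using (_≡_; _≢_; refl; cong₂)

record Graph : Set where
  field
    n      : ℕ
    adj    : Fin n → Fin n → Bool
    sym    : ∀ a b → adj a b ≡ adj b a
    irrefl : ∀ a → adj a a ≡ false
open Graph public

Vtx : Graph → Set
Vtx H = Fin (n H)

-- a k-clique-partition: an assignment of each vertex to one of k labelled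
-- (ordered, possibly empty) cliques; vertices with the same label are adjacent.
IsCliquePartition : (H : Graph) (k : ℕ) → (Vtx H → Fin k) → Set
IsCliquePartition H k c = ∀ a b → c a ≡ c b → a ≢ b → adj H a b ≡ true

HasCliquePartition : Graph → ℕ → Set
HasCliquePartition H k = Σ (Vtx H → Fin k) (IsCliquePartition H k)

IsFrozen : (H : Graph) (k : ℕ) → (Vtx H → Fin k) → Set
IsFrozen H k c = IsCliquePartition H k c ×
  (∀ a (j : Fin k) → j ≢ c a → Σ (Vtx H) λ w → c w ≡ j × adj H a w ≡ false)

HasFrozen : Graph → ℕ → Set
HasFrozen H k = Σ (Vtx H → Fin k) (IsFrozen H k)

ThetaIs : Graph → ℕ → Set
ThetaIs H k = HasCliquePartition H k × (∀ m → m < k → ¬ HasCliquePartition H m)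

C4Free : Graph → Set
C4Free H = ∀ a b c d → a ≢ c → b ≢ d →
  adj H a b ≡ true → adj H b c ≡ true → adj H c d ≡ true → adj H d a ≡ true →
  adj H a c ≡ false → adj H b d ≡ false → ⊥

MiddleOfDiamond : (H : Graph) → Vtx H → Vtx H → Set
MiddleOfDiamond H x y = adj H x y ≡ true × Σ (Vtx H) λ a → Σ (Vtx H) λ b → a ≢ b ×
  adj H a x ≡ true × adj H a y ≡ true × adj H b x ≡ true × adj H b y ≡ true ×
  adj H a b ≡ false

IsPairClique : (H : Graph) {k : ℕ} → (Vtx H → Fin k) → Vtx H → Vtx H → Set
IsPairClique H {k} c x y = Σ (Fin k) λ j → ∀ w → (c w ≡ j → (w ≡ x ⊎ w ≡ y)) × ((w ≡ x ⊎ w ≡ y) → c w ≡ j)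

-- Subdividing the edge xy twice.  Vertices of H' are Fin (2 + n):
-- zero = u, suc zero = v, suc (suc w) = old vertex w.
module _ {m : ℕ} (A : Fin m → Fin m → Bool) (x y : Fin m) where
  eqb : Fin m → Fin m → Bool
  eqb a b = ⌊ a ≟ b ⌋

  isxy : Fin m → Fin m → Bool
  isxy a b = (eqb a x ∧ eqb b y) ∨ (eqb a y ∧ eqb b x)

  subAdj : Fin (suc (suc m)) → Fin (suc (suc m)) → Bool
  subAdj zero zero = false
  subAdj zero (suc zero) = true
  subAdj (suc zero) zero = true
  subAdj (suc zero) (suc zero) = false
  subAdj zero (suc (suc w)) = eqb w x
  subAdj (suc (suc w)) zero = eqb w x
  subAdj (suc zero) (suc (suc w)) = eqb w y
  subAdj (suc (suc w)) (suc zero) = eqb w y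
  subAdj (suc (suc a)) (suc (suc b)) = A a b ∧ not (isxy a b)

  isxy-sym : ∀ a b → isxy a b ≡ isxy b a
  isxy-sym a b rewrite ∧-comm (eqb a x) (eqb b y) | ∧-comm (eqb a y) (eqb b x)
    = ∨-comm (eqb b y ∧ eqb a x) (eqb b x ∧ eqb a y)

subdivide : (H : Graph) → Vtx H → Vtx H → Graph
subdivide H x y = record
  { n = suc (suc (n H))
  ; adj = subAdj (adj H) x y
  ; sym = s
  ; irrefl = i }
  where
  s : ∀ a b → subAdj (adj H) x y a b ≡ subAdj (adj H) x y b a
  s zero zero = refl
  s zero (suc zero) = refl
  s (suc zero) zero = refl
  s (suc zero) (suc zero) = refl
  s zero (suc (suc w)) = refl
  s (suc (suc w)) zero = refl
  s (suc zero) (suc (suc w)) = refl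
  s (suc (suc w)) (suc zero) = refl
  s (suc (suc a)) (suc (suc b)) = cong₂ (λ p q → p ∧ not q) (sym H a b) (isxy-sym (adj H) x y a b)
  i : ∀ a → subAdj (adj H) x y a a ≡ false
  i zero = refl
  i (suc zero) = refl
  i (suc (suc a)) rewrite irrefl H a = refl

{-# OPTIONS --safe #-}
-- The new vertices u, v form a clique of their own; added to a clique partition
-- of H that separates x and y it gives a clique partition of H', frozen if the
-- old one was (case 1). In case 2 the frozen clique {x, y} is instead split into
-- {u, x} and {v, y}. Conversely, in a clique partition of H' the clique of u lies
-- in {u, v, x} and that of v in {u, v, y}; merging the two and deleting u, v
-- frees a label, so θ(H') > θ(H). An induced 4-cycle of H' cannot pass through
-- u, since its neighbours v and x have no common neighbour but u (dually for v).
-- On old vertices it is a 4-cycle of H unless xy is a chord, and then xy is the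
-- middle edge of a diamond; in case 2 that is impossible, as every vertex outside
-- the frozen clique {x, y} has a non-neighbour in it.
module Submission where

open import Defs
open import Data.Nat using (ℕ; zero; suc; _<_; s≤s)
open import Data.Fin using (Fin; zero; suc; _≟_; punchOut)
open import Data.Fin.Properties using (suc-injective; punchOut-injective)
open import Data.Bool using (true; false)
open import Data.Bool.Properties using (∧-conicalˡ; ∧-zeroʳ)
open import Data.Product using (Σ; _×_; _,_; proj₁; proj₂)
open import Data.Sum using (_⊎_; inj₁; inj₂; [_,_]′; fromInj₁)
open import Data.Empty using (⊥; ⊥-elim)
open import Function using (_∘_; case_of_)
open import Relation.Nullary using (Dec; does; yes; no; ¬_; contradiction)
open import Relation.Nullary.Decidable
  using (⌊_⌋; _×-dec_; _⊎-dec_; isYes≗does; dec-true; dec-false; decidable-stable)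
open import Relation.Binary.PropositionalEquality using (_≡_; _≢_; refl; trans; cong)
import Relation.Binary.PropositionalEquality as ≡

module _ {a} {A : Set a} where

  ⌊⌋-true : (a? : Dec A) → A → ⌊ a? ⌋ ≡ true
  ⌊⌋-true a? p = trans (isYes≗does a?) (dec-true a? p)

  ⌊⌋-false : (a? : Dec A) → ¬ A → ⌊ a? ⌋ ≡ false
  ⌊⌋-false a? ¬p = trans (isYes≗does a?) (dec-false a? ¬p)

  ⌊⌋-true⁻¹ : (a? : Dec A) → ⌊ a? ⌋ ≡ true → A
  ⌊⌋-true⁻¹ (yes p) _ = p

module _ (H : Graph) where

  edge-sym : ∀ {a b} → adj H a b ≡ true → adj H b a ≡ true
  edge-sym {a} {b} e = trans (sym H b a) e

  nonEdge-sym : ∀ {a b} → adj H a b ≡ false → adj H b a ≡ false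
  nonEdge-sym {a} {b} e = trans (sym H b a) e

  edge⇒¬nonEdge : ∀ {a b} → adj H a b ≡ true → ¬ adj H a b ≡ false
  edge⇒¬nonEdge ab ab′ with () ← trans (≡.sym ab) ab′

  edge⇒≢ : ∀ {a b} → adj H a b ≡ true → a ≢ b
  edge⇒≢ {a} aa refl = edge⇒¬nonEdge aa (irrefl H a)

  edge-nonEdge⇒≢ : ∀ {a b c} → adj H a b ≡ true → adj H a c ≡ false → b ≢ c
  edge-nonEdge⇒≢ ab ac refl = edge⇒¬nonEdge ab ac

NonNeighbourIn : (H : Graph) {k : ℕ} → (Vtx H → Fin k) → Vtx H → Fin k → Set
NonNeighbourIn H c a j = Σ (Vtx H) λ w → c w ≡ j × adj H a w ≡ false

dropUnusedLabel : ∀ H {m} (c : Vtx H → Fin (suc m)) {i} →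
  IsCliquePartition H (suc m) c → (∀ w → i ≢ c w) → HasCliquePartition H m
dropUnusedLabel H c cp unused =
  (λ w → punchOut (unused w)) ,
  λ a b e a≢b → cp a b (punchOut-injective (unused a) (unused b) e) a≢b

module _ (H : Graph) {k : ℕ} {F : Vtx H → Fin k} (F-frozen : IsFrozen H k F) where

  frozen-clique-member-≢ : ∀ {x y} → adj H x y ≡ true → F x ≢ F y →
    ∀ j → Σ (Vtx H) λ w → F w ≡ j × w ≢ x
  frozen-clique-member-≢ {x} {y} xy Fx≢Fy j with j ≟ F x
  ... | yes refl = let (w , Fw≡j , yw) = proj₂ F-frozen y j Fx≢Fy
                   in w , Fw≡j , edge-nonEdge⇒≢ H (edge-sym H xy) yw ∘ ≡.sym
  ... | no j≢Fx = let (w , Fw≡j , _) = proj₂ F-frozen x j j≢Fx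
                  in w , Fw≡j , λ w≡x → j≢Fx (trans (≡.sym Fw≡j) (cong F w≡x))

  frozen-pairClique-noCommonNeighbour : ∀ {x y a} → IsPairClique H F x y →
    adj H a x ≡ true → adj H a y ≡ true → ⊥
  frozen-pairClique-noCommonNeighbour {a = a} (j , pair) ax ay with F a ≟ j
  ... | yes Fa≡j = [ edge⇒≢ H ax , edge⇒≢ H ay ]′ (proj₁ (pair a) Fa≡j)
  ... | no Fa≢j =
    let (w , Fw≡j , aw) = proj₂ F-frozen a j (Fa≢j ∘ ≡.sym)
    in [ edge-nonEdge⇒≢ H ax aw ∘ ≡.sym , edge-nonEdge⇒≢ H ay aw ∘ ≡.sym ]′
         (proj₁ (pair w) Fw≡j)

record Square (G : Graph) (a b c d : Vtx G) : Set where
  field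
    a≢c : a ≢ c
    b≢d : b ≢ d
    ab : adj G a b ≡ true
    bc : adj G b c ≡ true
    cd : adj G c d ≡ true
    da : adj G d a ≡ true
    ¬ac : adj G a c ≡ false
    ¬bd : adj G b d ≡ false
open Square

module _ {G : Graph} where

  rotate : ∀ {a b c d} → Square G a b c d → Square G b c d a
  rotate S = record
    { a≢c = b≢d S ; b≢d = a≢c S ∘ ≡.sym
    ; ab = bc S ; bc = cd S ; cd = da S ; da = ab S
    ; ¬ac = ¬bd S ; ¬bd = nonEdge-sym G (¬ac S) }

  squareFree⇒C4Free : (∀ a b c d → ¬ Square G a b c d) → C4Free G
  squareFree⇒C4Free noSquare a b c d a≢c b≢d ab bc cd da ¬ac ¬bd =
    noSquare a b c d (record
      { a≢c = a≢c ; b≢d = b≢d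
       ; ab = ab ; bc = bc ; cd = cd ; da = da
       ; ¬ac = ¬ac ; ¬bd = ¬bd })

  -- If N(a) ⊆ {p, q} and a is the only common neighbour of p and q, the
  -- opposite corner c of a square through a would be a second one.
  square-avoids-degreeTwo : ∀ {a p q} →
    (∀ w → adj G a w ≡ true → w ≡ p ⊎ w ≡ q) →
    (∀ w → adj G p w ≡ true → adj G q w ≡ true → w ≡ a) →
    ∀ {b c d} → ¬ Square G a b c d
  square-avoids-degreeTwo neighbours common {b} {c} {d} S
    with neighbours b (ab S) | neighbours d (edge-sym G (da S))
  ... | inj₁ refl | inj₁ refl = b≢d S refl
  ... | inj₂ refl | inj₂ refl = b≢d S refl
  ... | inj₁ refl | inj₂ refl = a≢c S (≡.sym (common c (bc S) (edge-sym G (cd S))))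
  ... | inj₂ refl | inj₁ refl = a≢c S (≡.sym (common c (edge-sym G (cd S)) (bc S)))

pattern u = zero
pattern v = suc zero
pattern old w = suc (suc w)

module Subdivision (H : Graph) (x y : Vtx H) (xy : adj H x y ≡ true) where

  G : Graph
  G = subdivide H x y

  yx : adj H y x ≡ true
  yx = edge-sym H xy

  x≢y : x ≢ y
  x≢y = edge⇒≢ H xy

  old-≢ : ∀ {a b : Vtx H} → old a ≢ old b → a ≢ b
  old-≢ ne = ne ∘ cong {B = Vtx G} (λ w → old w)

  old-injective : ∀ {a b : Vtx H} → old a ≡ old b → a ≡ b
  old-injective = suc-injective ∘ suc-injective

  IsXY : Vtx H → Vtx H → Set
  IsXY a b = (a ≡ x × b ≡ y) ⊎ (a ≡ y × b ≡ x)

  isXY? : ∀ a b → Dec (IsXY a b)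
  isXY? a b = (a ≟ x ×-dec b ≟ y) ⊎-dec (a ≟ y ×-dec b ≟ x)

  isxy≡does-isXY? : ∀ a b → isxy (adj H) x y a b ≡ does (isXY? a b)
  isxy≡does-isXY? a b
    rewrite isYes≗does (a ≟ x) | isYes≗does (b ≟ y)
          | isYes≗does (a ≟ y) | isYes≗does (b ≟ x)
    = refl

  IsXY⇒edge : ∀ {a b} → IsXY a b → adj H a b ≡ true
  IsXY⇒edge (inj₁ (refl , refl)) = xy
  IsXY⇒edge (inj₂ (refl , refl)) = yx

  old-edge⇒edge : ∀ {a b} → adj G (old a) (old b) ≡ true → adj H a b ≡ true
  old-edge⇒edge = ∧-conicalˡ _ _

  nonEdge⇒old-nonEdge : ∀ {a b} → adj H a b ≡ false → adj G (old a) (old b) ≡ false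
  nonEdge⇒old-nonEdge ab rewrite ab = refl

  edge⇒old-edge : ∀ {a b} → adj H a b ≡ true → ¬ IsXY a b → adj G (old a) (old b) ≡ true
  edge⇒old-edge {a} {b} ab ¬xy
    rewrite ab | isxy≡does-isXY? a b | dec-false (isXY? a b) ¬xy = refl

  IsXY⇒old-nonEdge : ∀ {a b} → IsXY a b → adj G (old a) (old b) ≡ false
  IsXY⇒old-nonEdge {a} {b} p
    rewrite isxy≡does-isXY? a b | dec-true (isXY? a b) p = ∧-zeroʳ (adj H a b)

  old-nonEdge⇒IsXY : ∀ {a b} → adj H a b ≡ true → adj G (old a) (old b) ≡ false → IsXY a b
  old-nonEdge⇒IsXY {a} {b} ab ¬ab =
    decidable-stable (isXY? a b) λ ¬xy →
      edge⇒¬nonEdge G {old a} {old b} (edge⇒old-edge ab ¬xy) ¬ab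

  u-neighbours : ∀ w → adj G u w ≡ true → w ≡ v ⊎ w ≡ old x
  u-neighbours v _ = inj₁ refl
  u-neighbours (old w) e = inj₂ (cong old (⌊⌋-true⁻¹ (w ≟ x) e))

  v-neighbours : ∀ w → adj G v w ≡ true → w ≡ u ⊎ w ≡ old y
  v-neighbours u _ = inj₁ refl
  v-neighbours (old w) e = inj₂ (cong old (⌊⌋-true⁻¹ (w ≟ y) e))

  v-x-commonNeighbour : ∀ w → adj G v w ≡ true → adj G (old x) w ≡ true → w ≡ u
  v-x-commonNeighbour w vw xw with v-neighbours w vw
  ... | inj₁ w≡u = w≡u
  ... | inj₂ refl =
    ⊥-elim (edge⇒¬nonEdge G {old x} {old y} xw (IsXY⇒old-nonEdge (inj₁ (refl , refl))))

  u-y-commonNeighbour : ∀ w → adj G u w ≡ true → adj G (old y) w ≡ true → w ≡ v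
  u-y-commonNeighbour w uw yw with u-neighbours w uw
  ... | inj₁ w≡v = w≡v
  ... | inj₂ refl =
    ⊥-elim (edge⇒¬nonEdge G {old y} {old x} yw (IsXY⇒old-nonEdge (inj₂ (refl , refl))))

  liftPartition : ∀ {k} → (Vtx H → Fin k) → Vtx G → Fin (suc k)
  liftPartition P u = zero
  liftPartition P v = zero
  liftPartition P (old w) = suc (P w)

  liftPartition-isCliquePartition : ∀ {k} {P : Vtx H → Fin k} →
    IsCliquePartition H k P → P x ≢ P y → IsCliquePartition G (suc k) (liftPartition P)
  liftPartition-isCliquePartition cp Px≢Py u u _ u≢u = contradiction refl u≢u
  liftPartition-isCliquePartition cp Px≢Py u v _ _ = refl
  liftPartition-isCliquePartition cp Px≢Py v u _ _ = refl
  liftPartition-isCliquePartition cp Px≢Py v v _ v≢v = contradiction refl v≢v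
  liftPartition-isCliquePartition cp Px≢Py u (old _) () _
  liftPartition-isCliquePartition cp Px≢Py v (old _) () _
  liftPartition-isCliquePartition cp Px≢Py (old _) u () _
  liftPartition-isCliquePartition cp Px≢Py (old _) v () _
  liftPartition-isCliquePartition {P = P} cp Px≢Py (old a) (old b) e a≢b =
    edge⇒old-edge (cp a b Pa≡Pb (old-≢ a≢b)) λ where
      (inj₁ (refl , refl)) → Px≢Py Pa≡Pb
      (inj₂ (refl , refl)) → Px≢Py (≡.sym Pa≡Pb)
    where
    Pa≡Pb : P a ≡ P b
    Pa≡Pb = suc-injective e

  liftPartition-isFrozen : ∀ {k} {F : Vtx H → Fin (suc k)} →
    IsFrozen H (suc k) F → F x ≢ F y → IsFrozen G (suc (suc k)) (liftPartition F)
  liftPartition-isFrozen {F = F} F-frozen Fx≢Fy =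
    liftPartition-isCliquePartition (proj₁ F-frozen) Fx≢Fy , nonNeighbour
    where
    nonNeighbour : ∀ a j → j ≢ liftPartition F a → NonNeighbourIn G (liftPartition F) a j
    nonNeighbour u zero 0≢0 = contradiction refl 0≢0
    nonNeighbour v zero 0≢0 = contradiction refl 0≢0
    nonNeighbour u (suc j) _ =
      let (w , Fw≡j , w≢x) = frozen-clique-member-≢ H F-frozen xy Fx≢Fy j
      in old w , cong suc Fw≡j , ⌊⌋-false (w ≟ x) w≢x
    nonNeighbour v (suc j) _ =
      let (w , Fw≡j , w≢y) = frozen-clique-member-≢ H F-frozen yx (Fx≢Fy ∘ ≡.sym) j
      in old w , cong suc Fw≡j , ⌊⌋-false (w ≟ y) w≢y
    nonNeighbour (old a) zero _ with a ≟ x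
    ... | yes a≡x = v , refl , ⌊⌋-false (a ≟ y) (x≢y ∘ trans (≡.sym a≡x))
    ... | no a≢x = u , refl , ⌊⌋-false (a ≟ x) a≢x
    nonNeighbour (old a) (suc j) j≢Fa =
      let (w , Fw≡j , aw) = proj₂ F-frozen a j (j≢Fa ∘ cong suc)
      in old w , cong suc Fw≡j , nonEdge⇒old-nonEdge aw

  module PairSplit {k} {F : Vtx H → Fin (suc k)} (F-frozen : IsFrozen H (suc k) F)
                   (pair : IsPairClique H F x y) where

    j₀ : Fin (suc k)
    j₀ = proj₁ pair

    Fx : F x ≡ j₀
    Fx = proj₂ (proj₂ pair x) (inj₁ refl)

    Fy : F y ≡ j₀
    Fy = proj₂ (proj₂ pair y) (inj₂ refl)

    pair-≢y : ∀ {w} → F w ≡ j₀ → w ≢ y → w ≡ x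
    pair-≢y Fw≡j₀ w≢y = fromInj₁ (⊥-elim ∘ w≢y) (proj₁ (proj₂ pair _) Fw≡j₀)

    outside-≢x : ∀ {w} → F w ≢ j₀ → w ≢ x
    outside-≢x Fw≢j₀ refl = Fw≢j₀ Fx

    outside-≢y : ∀ {w} → F w ≢ j₀ → w ≢ y
    outside-≢y Fw≢j₀ refl = Fw≢j₀ Fy

    pairSplit : Vtx G → Fin (suc (suc k))
    pairSplit u = suc j₀
    pairSplit v = zero
    pairSplit (old w) with w ≟ y
    ... | yes _ = zero
    ... | no _ = suc (F w)

    pairSplit-y : pairSplit (old y) ≡ zero
    pairSplit-y with y ≟ y
    ... | yes _ = refl
    ... | no y≢y = contradiction refl y≢y

    pairSplit-old : ∀ {w} → w ≢ y → pairSplit (old w) ≡ suc (F w)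
    pairSplit-old {w} w≢y with w ≟ y
    ... | yes w≡y = contradiction w≡y w≢y
    ... | no _ = refl

    pairSplit-x : pairSplit (old x) ≡ suc j₀
    pairSplit-x = trans (pairSplit-old x≢y) (cong suc Fx)

    u-clique : ∀ w → suc j₀ ≡ pairSplit (old w) → adj G u (old w) ≡ true
    u-clique w with w ≟ y
    ... | yes _ = λ ()
    ... | no w≢y = λ e → ⌊⌋-true (w ≟ x) (pair-≢y (≡.sym (suc-injective e)) w≢y)

    v-clique : ∀ w → zero ≡ pairSplit (old w) → adj G v (old w) ≡ true
    v-clique w with w ≟ y
    ... | yes _ = λ _ → refl
    ... | no _ = λ ()

    old-clique : ∀ a b → pairSplit (old a) ≡ pairSplit (old b) → a ≢ b →
      adj H a b ≡ true × ¬ IsXY a b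
    old-clique a b e a≢b with a ≟ y | b ≟ y
    ... | yes refl | yes refl = contradiction refl a≢b
    ... | yes _ | no _ = contradiction e λ ()
    ... | no _ | yes _ = contradiction e λ ()
    ... | no a≢y | no b≢y =
      proj₁ F-frozen a b (suc-injective e) a≢b , [ b≢y ∘ proj₂ , a≢y ∘ proj₁ ]′

    pairSplit-isCliquePartition : IsCliquePartition G (suc (suc k)) pairSplit
    pairSplit-isCliquePartition u u _ u≢u = contradiction refl u≢u
    pairSplit-isCliquePartition v v _ v≢v = contradiction refl v≢v
    pairSplit-isCliquePartition u v () _
    pairSplit-isCliquePartition v u () _
    pairSplit-isCliquePartition u (old w) e _ = u-clique w e
    pairSplit-isCliquePartition v (old w) e _ = v-clique w e
    pairSplit-isCliquePartition (old w) u e _ = edge-sym G {u} {old w} (u-clique w (≡.sym e))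
    pairSplit-isCliquePartition (old w) v e _ = edge-sym G {v} {old w} (v-clique w (≡.sym e))
    pairSplit-isCliquePartition (old a) (old b) e a≢b =
      let (ab , ¬xy) = old-clique a b e (old-≢ a≢b) in edge⇒old-edge ab ¬xy

    ≢j₀⇒≢Fx : ∀ {j} → j ≢ j₀ → j ≢ F x
    ≢j₀⇒≢Fx j≢j₀ j≡Fx = j≢j₀ (trans j≡Fx Fx)

    ≢j₀⇒≢Fy : ∀ {j} → j ≢ j₀ → j ≢ F y
    ≢j₀⇒≢Fy j≢j₀ j≡Fy = j≢j₀ (trans j≡Fy Fy)

    outsideNonNeighbour : ∀ a {j} → j ≢ F a → j ≢ j₀ →
      Σ (Vtx H) λ w → pairSplit (old w) ≡ suc j × adj H a w ≡ false × w ≢ x × w ≢ y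
    outsideNonNeighbour a j≢Fa j≢j₀ =
      let (w , Fw≡j , aw) = proj₂ F-frozen a _ j≢Fa
          Fw≢j₀ = j≢j₀ ∘ trans (≡.sym Fw≡j)
      in w , trans (pairSplit-old (outside-≢y Fw≢j₀)) (cong suc Fw≡j) , aw ,
         outside-≢x Fw≢j₀ , outside-≢y Fw≢j₀

    pairNonNeighbour : ∀ a → j₀ ≢ F a → NonNeighbourIn G pairSplit (old a) (suc j₀)
    pairNonNeighbour a j₀≢Fa with proj₂ F-frozen a j₀ j₀≢Fa
    ... | w , Fw≡j₀ , aw with proj₁ (proj₂ pair w) Fw≡j₀
    ...   | inj₁ refl = old x , pairSplit-x , nonEdge⇒old-nonEdge aw
    ...   | inj₂ refl = u , refl , ⌊⌋-false (a ≟ x) (outside-≢x (j₀≢Fa ∘ ≡.sym))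

    nonNeighbour-u : ∀ j → j ≢ suc j₀ → NonNeighbourIn G pairSplit u j
    nonNeighbour-u zero _ = old y , pairSplit-y , ⌊⌋-false (y ≟ x) (x≢y ∘ ≡.sym)
    nonNeighbour-u (suc j) sj≢sj₀ =
      let j≢j₀ = sj≢sj₀ ∘ cong suc
          (w , label , _ , w≢x , _) = outsideNonNeighbour x (≢j₀⇒≢Fx j≢j₀) j≢j₀
      in old w , label , ⌊⌋-false (w ≟ x) w≢x

    nonNeighbour-v : ∀ j → j ≢ zero → NonNeighbourIn G pairSplit v j
    nonNeighbour-v zero 0≢0 = contradiction refl 0≢0
    nonNeighbour-v (suc j) _ with j ≟ j₀
    ... | yes refl = old x , pairSplit-x , ⌊⌋-false (x ≟ y) x≢y
    ... | no j≢j₀ =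
      let (w , label , _ , _ , w≢y) = outsideNonNeighbour y (≢j₀⇒≢Fy j≢j₀) j≢j₀
      in old w , label , ⌊⌋-false (w ≟ y) w≢y

    nonNeighbour-y : ∀ j → j ≢ zero → NonNeighbourIn G pairSplit (old y) j
    nonNeighbour-y zero 0≢0 = contradiction refl 0≢0
    nonNeighbour-y (suc j) _ with j ≟ j₀
    ... | yes refl = u , refl , ⌊⌋-false (y ≟ x) (x≢y ∘ ≡.sym)
    ... | no j≢j₀ =
      let (w , label , yw , _) = outsideNonNeighbour y (≢j₀⇒≢Fy j≢j₀) j≢j₀
      in old w , label , nonEdge⇒old-nonEdge yw

    nonNeighbour-≢y : ∀ {a} → a ≢ y →
      ∀ j → j ≢ suc (F a) → NonNeighbourIn G pairSplit (old a) j
    nonNeighbour-≢y {a} a≢y zero _ = v , refl , ⌊⌋-false (a ≟ y) a≢y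
    nonNeighbour-≢y {a} _ (suc j) sj≢sFa with j ≟ j₀
    ... | yes refl = pairNonNeighbour a (sj≢sFa ∘ cong suc)
    ... | no j≢j₀ =
      let (w , label , aw , _) = outsideNonNeighbour a (sj≢sFa ∘ cong suc) j≢j₀
      in old w , label , nonEdge⇒old-nonEdge aw

    nonNeighbour : ∀ a j → j ≢ pairSplit a → NonNeighbourIn G pairSplit a j
    nonNeighbour u = nonNeighbour-u
    nonNeighbour v = nonNeighbour-v
    nonNeighbour (old a) j j≢ with a ≟ y
    ... | yes refl = nonNeighbour-y j j≢
    ... | no a≢y = nonNeighbour-≢y a≢y j j≢

    pairSplit-isFrozen : IsFrozen G (suc (suc k)) pairSplit
    pairSplit-isFrozen = pairSplit-isCliquePartition , nonNeighbour

  module Contraction {m} (c : Vtx G → Fin (suc m)) (cp : IsCliquePartition G (suc m) c) where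

    u-clique-old : ∀ {w} → c (old w) ≡ c u → w ≡ x
    u-clique-old {w} e = ⌊⌋-true⁻¹ (w ≟ x) (cp u (old w) (≡.sym e) λ ())

    v-clique-old : ∀ {w} → c v ≡ c (old w) → w ≡ y
    v-clique-old {w} e = ⌊⌋-true⁻¹ (w ≟ y) (cp v (old w) e λ ())

    merged : Vtx H → Fin (suc m)
    merged w with c (old w) ≟ c u
    ... | yes _ = c v
    ... | no _ = c (old w)

    merged-avoids-u : ∀ w → c u ≢ merged w
    merged-avoids-u w with c (old w) ≟ c u
    ... | yes w∈u = λ cu≡cv →
      x≢y (trans (≡.sym (u-clique-old w∈u)) (v-clique-old (≡.sym (trans w∈u cu≡cv))))
    ... | no w∉u = w∉u ∘ ≡.sym

    merged-isCliquePartition : IsCliquePartition H (suc m) merged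
    merged-isCliquePartition a b e a≢b with c (old a) ≟ c u | c (old b) ≟ c u
    ... | yes a∈u | yes b∈u = contradiction (trans (u-clique-old a∈u) (≡.sym (u-clique-old b∈u))) a≢b
    ... | yes a∈u | no _ = IsXY⇒edge (inj₁ (u-clique-old a∈u , v-clique-old e))
    ... | no _ | yes b∈u = IsXY⇒edge (inj₂ (v-clique-old (≡.sym e) , u-clique-old b∈u))
    ... | no _ | no _ = old-edge⇒edge (cp (old a) (old b) e (a≢b ∘ old-injective))

  contract : ∀ {m} → HasCliquePartition G (suc m) → HasCliquePartition H m
  contract (c , cp) = dropUnusedLabel H merged merged-isCliquePartition merged-avoids-u
    where open Contraction c cp

  subdivide-θ : ∀ {k} → HasCliquePartition G (suc k) → ThetaIs H k → ThetaIs G (suc k)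
  subdivide-θ {k} partition (_ , minimal) = partition , noSmaller
    where
    noSmaller : ∀ m → m < suc k → ¬ HasCliquePartition G m
    noSmaller zero _ (c , _) = case c u of λ ()
    noSmaller (suc m) (s≤s m<k) p = minimal m m<k (contract p)

  square-xy⇒diamond : ∀ {b d} → Square G (old x) (old b) (old y) (old d) → MiddleOfDiamond H x y
  square-xy⇒diamond {b} {d} S = xy , b , d , old-≢ (b≢d S) , bx , by , dx , dy , ¬bd′
    where
    bx : adj H b x ≡ true
    bx = edge-sym H (old-edge⇒edge (ab S))
    by : adj H b y ≡ true
    by = old-edge⇒edge (bc S)
    dx : adj H d x ≡ true
    dx = old-edge⇒edge (da S)
    dy : adj H d y ≡ true
    dy = edge-sym H (old-edge⇒edge (cd S))
    ¬bd′ : adj H b d ≡ false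
    ¬bd′ with adj H b d in bd
    ... | false = refl
    ... | true =
      ⊥-elim ([ edge⇒≢ H bx ∘ proj₁ , edge⇒≢ H by ∘ proj₁ ]′ (old-nonEdge⇒IsXY bd (¬bd S)))

  chord⇒diamond : ∀ {a b c d} → Square G (old a) (old b) (old c) (old d) →
    adj H a c ≡ true → MiddleOfDiamond H x y
  chord⇒diamond S ac with old-nonEdge⇒IsXY ac (¬ac S)
  ... | inj₁ (refl , refl) = square-xy⇒diamond S
  ... | inj₂ (refl , refl) = square-xy⇒diamond (rotate (rotate S))

  subdivide-C4Free : C4Free H → ¬ MiddleOfDiamond H x y → C4Free G
  subdivide-C4Free c4Free noDiamond = squareFree⇒C4Free noSquare
    where
    noSquare-u : ∀ {b c d} → ¬ Square G u b c d
    noSquare-u = square-avoids-degreeTwo u-neighbours v-x-commonNeighbour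

    noSquare-v : ∀ {b c d} → ¬ Square G v b c d
    noSquare-v = square-avoids-degreeTwo v-neighbours u-y-commonNeighbour

    noSquare-old : ∀ {a b c d} → ¬ Square G (old a) (old b) (old c) (old d)
    noSquare-old {a} {b} {c} {d} S with adj H a c in ac | adj H b d in bd
    ... | true | _ = noDiamond (chord⇒diamond S ac)
    ... | false | true = noDiamond (chord⇒diamond (rotate S) bd)
    ... | false | false =
      c4Free a b c d (old-≢ (a≢c S)) (old-≢ (b≢d S))
        (old-edge⇒edge (ab S)) (old-edge⇒edge (bc S))
        (old-edge⇒edge (cd S)) (old-edge⇒edge (da S))
        ac bd

    noSquare : ∀ a b c d → ¬ Square G a b c d
    noSquare u _ _ _ = noSquare-u
    noSquare v _ _ _ = noSquare-v
    noSquare (old _) u _ _ = noSquare-u ∘ rotate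
    noSquare (old _) v _ _ = noSquare-v ∘ rotate
    noSquare (old _) (old _) u _ = noSquare-u ∘ rotate ∘ rotate
    noSquare (old _) (old _) v _ = noSquare-v ∘ rotate ∘ rotate
    noSquare (old _) (old _) (old _) u = noSquare-u ∘ rotate ∘ rotate ∘ rotate
    noSquare (old _) (old _) (old _) v = noSquare-v ∘ rotate ∘ rotate ∘ rotate
    noSquare (old _) (old _) (old _) (old _) = noSquare-old

theorem15 : (H : Graph) (k : ℕ)
    (Q : Vtx H → Fin k) → IsCliquePartition H k Q →
    (F : Vtx H → Fin (suc k)) → IsFrozen H (suc k) F →
    (x y : Vtx H) → adj H x y ≡ true → Q x ≢ Q y →
    (F x ≢ F y ⊎ IsPairClique H F x y) →
    HasCliquePartition (subdivide H x y) (suc k)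
    × HasFrozen (subdivide H x y) (suc (suc k))
    × (ThetaIs H k → ThetaIs (subdivide H x y) (suc k))
    × (C4Free H → (F x ≢ F y → ¬ MiddleOfDiamond H x y) → C4Free (subdivide H x y))
theorem15 H k Q Q-partition F F-frozen x y xy Qx≢Qy case₁₂ =
  partition , frozen case₁₂ , subdivide-θ partition ,
  λ c4Free diamondFree₁ → subdivide-C4Free c4Free (diamondFree case₁₂ diamondFree₁)
  where
  open Subdivision H x y xy

  partition : HasCliquePartition G (suc k)
  partition = liftPartition Q , liftPartition-isCliquePartition Q-partition Qx≢Qy

  frozen : F x ≢ F y ⊎ IsPairClique H F x y → HasFrozen G (suc (suc k))
  frozen (inj₁ Fx≢Fy) = liftPartition F , liftPartition-isFrozen F-frozen Fx≢Fy
  frozen (inj₂ pair) = pairSplit , pairSplit-isFrozen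
    where open PairSplit F-frozen pair

  diamondFree : F x ≢ F y ⊎ IsPairClique H F x y →
    (F x ≢ F y → ¬ MiddleOfDiamond H x y) → ¬ MiddleOfDiamond H x y
  diamondFree (inj₁ Fx≢Fy) diamondFree₁ = diamondFree₁ Fx≢Fy
  diamondFree (inj₂ pair) _ (_ , a , _ , _ , ax , ay , _) =
    frozen-pairClique-noCommonNeighbour H F-frozen pair ax ay
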